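{- Let $\mathcal{I}$ be an instance of 3-SAT and let $G=G(\mathcal{I})$ be the graph defined in the context. If $\mathcal{I}$ has no satisfying assignment, then $t$ is not the end-vertex (last vertex) of any MNS ordering of $G$.
   Context: Construction of $G(\mathcal{I})$ for a 3-SAT instance $\mathcal{I}$ with variables $x_1,\dots,x_k$ and clauses $c_1,\dots,c_l$ (each clause a disjunction of three literals): the vertex set consists of literal vertices $X=\{x_1,\dots,x_k,\overline{x}_1,\dots,\overline{x}_k\}$, clause vertices $C=\{c_1,\dots,c_l\}$, and three further vertices $s,b,t$. Edges: every pair of distinct literal vertices is adjacent except the pairs $x_i\overline{x}_i$ ($1\le i\le k$); $C$ is an independent set; each clause vertex $c_j$ is adjacent to every literal vertex except the literal vertices corresponding to the literals occurring in clause $c_j$; $b$ is adjacent to all literal vertices; $s$ and $t$ are each adjacent to all literal vertices and all clause vertices; and $bt$ is an edge. There are no other edges. An MNS ordering is an ordering produced by: choose an arbitrary first vertex; at each subsequent step, where the label of an unnumbered vertex $w$ is the set of positions of already numbered neighbours of $w$, number next an unnumbered vertex whose label is maximal under set inclusion among unnumbered vertices (any tie-break allowed). -}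

module Defs where

open import Data.Nat using (ℕ; suc)
open import Data.Fin using (Fin; _<_; _≤_; fromℕ)
open import Data.Bool using (Bool)
open import Data.Product using (_×_; _,_; ∃; ∃-syntax)
open import Data.Empty using (⊥)
open import Data.Unit using (⊤)
open import Relation.Nullary using (¬_)
open import Relation.Binary.PropositionalEquality using (_≡_; _≢_)
open import Function.Definitions using (Injective)

-- A literal over variables x_1..x_k: (variable index, polarity);
-- polarity true = x_i, false = ¬x_i.
Literal : ℕ → Set
Literal k = Fin k × Bool

record Instance : Set where
  field
    k : ℕ
    l : ℕ
    clause : Fin l → Fin 3 → Literal k
open Instance public

Occurs : (I : Instance) → Literal (k I) → Fin (l I) → Set
Occurs I ℓ j = ∃[ r ] clause I j r ≡ ℓ

TrueLit : ∀ {k} → (Fin k → Bool) → Literal k → Set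
TrueLit α (i , p) = α i ≡ p

Satisfiable : Instance → Set
Satisfiable I = ∃[ α ] (∀ (j : Fin (l I)) → ∃[ r ] TrueLit α (clause I j r))

data Vertex (I : Instance) : Set where
  lit : Literal (k I) → Vertex I
  cl  : Fin (l I) → Vertex I
  s b t : Vertex I

-- Edges of G(I).  Two literal vertices (i,p), (j,q) are adjacent iff they are
-- distinct and not complementary, i.e. iff i ≢ j.
Adj : (I : Instance) → Vertex I → Vertex I → Set
Adj I (lit (i , p)) (lit (j , q)) = i ≢ j
Adj I (lit ℓ) (cl j) = ¬ Occurs I ℓ j
Adj I (cl j) (lit ℓ) = ¬ Occurs I ℓ j
Adj I (lit _) s = ⊤
Adj I s (lit _) = ⊤
Adj I (lit _) b = ⊤
Adj I b (lit _) = ⊤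
Adj I (lit _) t = ⊤
Adj I t (lit _) = ⊤
Adj I (cl _) s = ⊤
Adj I s (cl _) = ⊤
Adj I (cl _) t = ⊤
Adj I t (cl _) = ⊤
Adj I b t = ⊤
Adj I t b = ⊤
Adj I _ _ = ⊥

IsOrdering : (I : Instance) → {n : ℕ} → (Fin n → Vertex I) → Set
IsOrdering I σ = Injective _≡_ _≡_ σ × (∀ v → ∃[ i ] σ i ≡ v)

-- label of w at step i: the set of positions j < i with σ j adjacent to w.
-- label_i(v) ⊊ label_i(w):
LabelStrictSub : (I : Instance) → {n : ℕ} → (Fin n → Vertex I) →
                 Fin n → Vertex I → Vertex I → Set
LabelStrictSub I σ i v w =
  (∀ j → j < i → Adj I (σ j) v → Adj I (σ j) w) ×
  (∃[ j ] (j < i × Adj I (σ j) w × ¬ Adj I (σ j) v))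

IsMNS : (I : Instance) → {n : ℕ} → (Fin n → Vertex I) → Set
IsMNS I σ = IsOrdering I σ ×
  (∀ i m → i ≤ m → ¬ LabelStrictSub I σ i (σ i) (σ m))

-- Suppose an MNS ordering of G(I) ends at t.  When a vertex v is numbered while
-- w is still unnumbered, the label of v cannot be strictly contained in that of
-- w.  As N(s) ⊆ N(t) and N(b) ⊆ N(t) ∪ {t}, this puts s before b (b is adjacent
-- to t but not to s) and b before every clause vertex c (c is adjacent to t but
-- not to b).  Let ℓ be the first numbered literal of a clause c.  Every literal
-- numbered before ℓ is missing from c, hence adjacent to c; so ℓ comes before b
-- (otherwise label(b) ⊊ label(c), witnessed by s) and before its complement ℓ̄
-- (otherwise label(ℓ) ⊊ label(c), witnessed by ℓ̄).  Making true exactly the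
-- literals numbered before their complements thus satisfies every clause.
module Submission where

open import Defs
open import Data.Nat using (ℕ; zero; suc)
open import Data.Fin using (Fin; zero; suc; fromℕ; _<_; _≤_; _<?_)
import Data.Fin.Properties as Fin
import Data.Nat.Properties as ℕ
open import Data.Bool using (Bool; true; false; not)
open import Data.Product using (_,_; ∃-syntax; proj₁; proj₂)
open import Data.Sum using (inj₁; inj₂)
open import Data.Empty using (⊥; ⊥-elim)
open import Data.Unit using (tt)
open import Function using (_∘_)
open import Relation.Nullary using (¬_; does)
open import Relation.Nullary.Decidable using (dec-true; dec-false)
open import Relation.Binary.PropositionalEquality
  using (_≡_; _≢_; refl; sym; trans; cong; subst; subst₂)

argmin : ∀ {m N} (f : Fin (suc m) → Fin N) → ∃[ r ] (∀ r′ → f r ≤ f r′)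
argmin {zero} f = zero , λ { zero → Fin.≤-refl }
argmin {suc m} f with argmin (f ∘ suc)
... | r , min with Fin.≤-total (f zero) (f (suc r))
...   | inj₁ f0≤ = zero , λ { zero → Fin.≤-refl ; (suc r′) → Fin.≤-trans f0≤ (min r′) }
...   | inj₂ ≤f0 = suc r , λ { zero → ≤f0 ; (suc r′) → min r′ }

complement : ∀ {k} → Literal k → Literal k
complement (i , p) = i , not p

module _ {I : Instance} where

  lit≢complement : ∀ ℓ → lit {I} ℓ ≢ lit (complement ℓ)
  lit≢complement (_ , true)  ()
  lit≢complement (_ , false) ()

  s-nbr⇒t-nbr : ∀ w → Adj I w s → Adj I w t
  s-nbr⇒t-nbr (lit _) _ = tt
  s-nbr⇒t-nbr (cl _)  _ = tt

  b-nbr⇒t-nbr : ∀ w → w ≢ t → Adj I w b → Adj I w t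
  b-nbr⇒t-nbr (lit _) _   _ = tt
  b-nbr⇒t-nbr t       w≢t _ = ⊥-elim (w≢t refl)

module MNSOrdering (I : Instance) {n : ℕ} (σ : Fin n → Vertex I)
                   (mns : IsMNS I σ) where

  pos : Vertex I → Fin n
  pos v = proj₁ (proj₂ (proj₁ mns) v)

  σ-pos : ∀ v → σ (pos v) ≡ v
  σ-pos v = proj₂ (proj₂ (proj₁ mns) v)

  pos-σ : ∀ j → pos (σ j) ≡ j
  pos-σ j = proj₁ (proj₁ mns) (σ-pos (σ j))

  precedes : ∀ {v w} → v ≢ w → ¬ pos w < pos v → pos v < pos w
  precedes {v} {w} v≢w w≮v = Fin.≤∧≢⇒< (ℕ.≮⇒≥ w≮v) pos≢
    where pos≢ : pos v ≢ pos w
          pos≢ e = v≢w (trans (sym (σ-pos v)) (trans (cong σ e) (σ-pos w)))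

  label-not-dominated : ∀ {v w} → pos v ≤ pos w →
    (∀ u → pos u < pos v → Adj I u v → Adj I u w) →
    ∀ u → pos u < pos v → Adj I u w → ¬ Adj I u v → ⊥
  label-not-dominated {v} {w} v≤w dominated u u<v uw ¬uv =
    proj₂ mns (pos v) (pos w) v≤w (label⊆ , pos u , u<v , at-pos uw , ¬uv ∘ from-pos)
    where
      at-pos : ∀ {x y} → Adj I x y → Adj I (σ (pos x)) (σ (pos y))
      at-pos {x} {y} = subst₂ (Adj I) (sym (σ-pos x)) (sym (σ-pos y))
      from-pos : ∀ {x y} → Adj I (σ (pos x)) (σ (pos y)) → Adj I x y
      from-pos {x} {y} = subst₂ (Adj I) (σ-pos x) (σ-pos y)
      label⊆ : ∀ j → j < pos v → Adj I (σ j) (σ (pos v)) → Adj I (σ j) (σ (pos w))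
      label⊆ j j<v jv = subst (Adj I (σ j)) (sym (σ-pos w))
        (dominated (σ j) (subst (_< pos v) (sym (pos-σ j)) j<v) (subst (Adj I (σ j)) (σ-pos v) jv))

module EndingAtT (I : Instance) (n : ℕ) (σ : Fin (suc n) → Vertex I)
                 (mns : IsMNS I σ) (σ-last : σ (fromℕ n) ≡ t) where

  open MNSOrdering I σ mns

  pos-t : pos t ≡ fromℕ n
  pos-t = proj₁ (proj₁ mns) (trans (σ-pos t) (sym σ-last))

  ≤-pos-t : ∀ v → pos v ≤ pos t
  ≤-pos-t v rewrite pos-t = Fin.≤fromℕ (pos v)

  earlier⇒≢t : ∀ {u v} → pos u < pos v → u ≢ t
  earlier⇒≢t {v = v} u<v refl = ℕ.<⇒≱ u<v (≤-pos-t v)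

  s≺b : pos s < pos b
  s≺b = precedes (λ ()) λ b<s →
    label-not-dominated (≤-pos-t s) (λ u _ → s-nbr⇒t-nbr u) b b<s tt (λ ())

  b≺cl : ∀ c → pos b < pos (cl c)
  b≺cl c = precedes (λ ()) λ c<b →
    label-not-dominated (≤-pos-t b) (λ u u<b → b-nbr⇒t-nbr u (earlier⇒≢t u<b))
      (cl c) c<b tt (λ ())

  module FirstLiteral (c : Fin (l I)) where

    first-numbered : ∃[ r ] (∀ r′ → pos (lit (clause I c r)) ≤ pos (lit (clause I c r′)))
    first-numbered = argmin (λ r → pos (lit (clause I c r)))

    ℓ : Literal (k I)
    ℓ = clause I c (proj₁ first-numbered)

    earlier⇒∉ : ∀ ℓ′ → pos (lit ℓ′) < pos (lit ℓ) → ¬ Occurs I ℓ′ c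
    earlier⇒∉ ℓ′ ℓ′<ℓ (r , refl) = ℕ.<⇒≱ ℓ′<ℓ (proj₂ first-numbered r)

    ℓ≺b : pos (lit ℓ) < pos b
    ℓ≺b = precedes (λ ()) λ b<ℓ →
      label-not-dominated (ℕ.<⇒≤ (b≺cl c)) (dominated b<ℓ) s s≺b tt (λ ())
      where
        dominated : pos b < pos (lit ℓ) → ∀ u → pos u < pos b → Adj I u b → Adj I u (cl c)
        dominated b<ℓ (lit ℓ′) u<b _ = earlier⇒∉ ℓ′ (ℕ.<-trans u<b b<ℓ)
        dominated _   t        u<b _ = ⊥-elim (earlier⇒≢t u<b refl)

    ℓ≺complement : pos (lit ℓ) < pos (lit (complement ℓ))
    ℓ≺complement = precedes (lit≢complement ℓ) λ ℓ̄<ℓ →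
      label-not-dominated (ℕ.<⇒≤ (ℕ.<-trans ℓ≺b (b≺cl c))) dominated
        (lit (complement ℓ)) ℓ̄<ℓ (earlier⇒∉ (complement ℓ) ℓ̄<ℓ) (λ i≢i → i≢i refl)
      where
        dominated : ∀ u → pos u < pos (lit ℓ) → Adj I u (lit ℓ) → Adj I u (cl c)
        dominated (lit ℓ′) u<ℓ _ = earlier⇒∉ ℓ′ u<ℓ
        dominated (cl c′)  u<ℓ _ = ⊥-elim (ℕ.<-asym u<ℓ (ℕ.<-trans ℓ≺b (b≺cl c′)))
        dominated s        _   _ = tt
        dominated b        u<ℓ _ = ⊥-elim (ℕ.<-asym u<ℓ ℓ≺b)
        dominated t        u<ℓ _ = ⊥-elim (earlier⇒≢t u<ℓ refl)

  assignment : Fin (k I) → Bool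
  assignment i = does (pos (lit (i , true)) <? pos (lit (i , false)))

  earlier-than-complement⇒true : ∀ ℓ → pos (lit ℓ) < pos (lit (complement ℓ)) →
    TrueLit assignment ℓ
  earlier-than-complement⇒true (i , true)  lt = dec-true  (_ <? _) lt
  earlier-than-complement⇒true (i , false) lt = dec-false (_ <? _) (ℕ.<-asym lt)

  assignment-satisfies : ∀ c → ∃[ r ] TrueLit assignment (clause I c r)
  assignment-satisfies c =
    proj₁ first-numbered , earlier-than-complement⇒true ℓ ℓ≺complement
    where open FirstLiteral c

lemma6 : (I : Instance) → ¬ Satisfiable I →
    ∀ (n : ℕ) (σ : Fin (suc n) → Vertex I) → IsMNS I σ → σ (fromℕ n) ≢ t
lemma6 I unsat n σ mns σ-last = unsat (assignment , assignment-satisfies)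
  where open EndingAtT I n σ mns σ-last
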